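{- Let $\{x_{n,l}\}$ be real numbers indexed by positive integers $n,l$, and for $n\ge 1$ and $m\in\mathbb{Z}$ put $X_{n,m}=\prod_{l=1}^{n}(m+x_{n,l})$ and $\mathscr{X}_n=\sum_{l=1}^{n}x_{n,l}$. Then for every $n\ge 1$, \[ \mathscr{X}_n=\frac{(-1)^n}{n!}\sum_{l=1}^{n}(-1)^l\binom{n}{l}\,l\,X_{n,l}-\frac12 n(n+1). \]
   Context: Given a two-parameter set of real numbers $\{x_{n,l}\}$, the associated "family of number sequences" consists of the numbers $X_{n,m}=\prod_{l=1}^n(m+x_{n,l})$, $n\ge1$, $m\in\mathbb{Z}$; $\mathscr{X}_n$ denotes $\sum_{l=1}^n x_{n,l}$. -}

module Defs where

open import Level using (Level)
open import Algebra.Bundles using (CommutativeRing)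
open import Data.Nat using (ℕ; zero; suc)
open import Data.Integer using (ℤ; +_; -[1+_])
open import Data.Nat.Combinatorics using (_C_)

-- Everything is stated over an arbitrary commutative ring R (the paper's
-- setting is R = ℝ, which is not available in agda-stdlib).
module Fam {c ℓ : Level} (R : CommutativeRing c ℓ) where
  open CommutativeRing R

  fromℕ : ℕ → Carrier
  fromℕ zero    = 0#
  fromℕ (suc k) = 1# + fromℕ k

  fromℤ : ℤ → Carrier
  fromℤ (+ k)     = fromℕ k
  fromℤ -[1+ k ]  = - fromℕ (suc k)

  sgn : ℕ → Carrier
  sgn zero    = 1#
  sgn (suc k) = - 1# * sgn k

  sum1 : ℕ → (ℕ → Carrier) → Carrier
  sum1 zero    f = 0#
  sum1 (suc n) f = sum1 n f + f (suc n)

  prod1 : ℕ → (ℕ → Carrier) → Carrier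
  prod1 zero    f = 1#
  prod1 (suc n) f = prod1 n f * f (suc n)

  -- the family x_{n,l} is a function x n l (only 1 ≤ l ≤ n is used)
  -- X_{n,m} = Π_{l=1}^{n} (m + x_{n,l}),  m ∈ ℤ
  X : (ℕ → ℕ → Carrier) → ℕ → ℤ → Carrier
  X x n m = prod1 n (λ l → fromℤ m + x n l)

  𝒳 : (ℕ → ℕ → Carrier) → ℕ → Carrier
  𝒳 x n = sum1 n (λ l → x n l)

  S : (ℕ → ℕ → Carrier) → ℕ → Carrier
  S x n = sum1 n (λ l → sgn l * fromℕ (n C l) * fromℕ l * X x n (+ l))

{-# OPTIONS --safe #-}
module Submission where

-- X_{n,l} = P(l) for the monic polynomial P(t) = ∏ᵢ (t + x_{n,i}) = tⁿ + 𝒳ₙ tⁿ⁻¹ + …, so the sum in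
-- the formula is Σₗ (-1)ˡ (n choose l) l P(l), which is (-1)ⁿ times the n-th forward difference at 0
-- of t P(t). That difference annihilates degrees below n, sends tⁿ to (-1)ⁿ n! and tⁿ⁺¹ to
-- (-1)ⁿ n! n(n+1)/2. Instead of expanding in monomials we induct on the number of linear factors,
-- using the absorption identity (j+1)(k+1 choose j+1) = (k+1)(k choose j) in the form
-- Σₗ (-1)ˡ (k+1 choose l) l g(l) = -(k+1) Σⱼ (-1)ʲ (k choose j) g(j+1).

open import Defs
open import Level using (Level)
open import Algebra.Bundles using (CommutativeRing)
open import Data.Nat using (ℕ; zero; suc; _≤_; _<_; _*_; _!; s≤s)
import Data.Nat as ℕ
open import Data.Nat.Properties using (n<1+n; m<n⇒m<1+n)
import Data.Nat.Properties as ℕₚ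
open import Data.Nat.Combinatorics using (_C_; nC1≡n; k>n⇒nCk≡0; nCk+nC[k+1]≡[n+1]C[k+1])
open import Data.Nat.Tactic.RingSolver using (solve-∀)
open import Function using (_∘_)
import Relation.Binary.PropositionalEquality as ≡

[k+1]*[n+1]C[k+1]≡[n+1]*nCk : ∀ n k → suc k * (suc n C suc k) ≡.≡ suc n * (n C k)
[k+1]*[n+1]C[k+1]≡[n+1]*nCk zero    zero    = ≡.refl
[k+1]*[n+1]C[k+1]≡[n+1]*nCk zero    (suc k) = ℕₚ.*-zeroʳ (suc (suc k))
[k+1]*[n+1]C[k+1]≡[n+1]*nCk (suc n) zero    =
  ≡.trans (ℕₚ.*-identityˡ _) (≡.trans (nC1≡n (suc (suc n))) (≡.sym (ℕₚ.*-identityʳ _)))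
[k+1]*[n+1]C[k+1]≡[n+1]*nCk (suc n) (suc k) = begin
    suc (suc k) * (suc (suc n) C suc (suc k))
  ≡⟨ ≡.cong (suc (suc k) *_) (nCk+nC[k+1]≡[n+1]C[k+1] (suc n) (suc k)) ⟨
    suc (suc k) * (A ℕ.+ B)
  ≡⟨ expand k A B ⟩
    suc k * A ℕ.+ A ℕ.+ suc (suc k) * B
  ≡⟨ ≡.cong₂ (λ u v → u ℕ.+ A ℕ.+ v) ([k+1]*[n+1]C[k+1]≡[n+1]*nCk n k)
                                      ([k+1]*[n+1]C[k+1]≡[n+1]*nCk n (suc k)) ⟩
    suc n * (n C k) ℕ.+ A ℕ.+ suc n * (n C suc k)
  ≡⟨ collect n (n C k) A (n C suc k) ⟩
    suc n * (n C k ℕ.+ n C suc k) ℕ.+ A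
  ≡⟨ ≡.cong (λ u → suc n * u ℕ.+ A) (nCk+nC[k+1]≡[n+1]C[k+1] n k) ⟩
    suc n * A ℕ.+ A
  ≡⟨ absorb n A ⟩
    suc (suc n) * A
  ∎
  where
  open ≡.≡-Reasoning
  A = suc n C suc k
  B = suc n C suc (suc k)
  expand : ∀ k a b → suc (suc k) * (a ℕ.+ b) ≡.≡ suc k * a ℕ.+ a ℕ.+ suc (suc k) * b
  expand = solve-∀
  collect : ∀ n c a d → suc n * c ℕ.+ a ℕ.+ suc n * d ≡.≡ suc n * (c ℕ.+ d) ℕ.+ a
  collect = solve-∀
  absorb : ∀ n a → suc n * a ℕ.+ a ≡.≡ suc (suc n) * a
  absorb = solve-∀

triangular : ℕ → ℕ
triangular zero    = 0
triangular (suc n) = suc n ℕ.+ triangular n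

triangular[n]*2≡n*[1+n] : ∀ n → triangular n * 2 ≡.≡ n * suc n
triangular[n]*2≡n*[1+n] zero    = ≡.refl
triangular[n]*2≡n*[1+n] (suc n) = begin
    (suc n ℕ.+ triangular n) * 2
  ≡⟨ ℕₚ.*-distribʳ-+ 2 (suc n) (triangular n) ⟩
    suc n * 2 ℕ.+ triangular n * 2
  ≡⟨ ≡.cong (suc n * 2 ℕ.+_) (triangular[n]*2≡n*[1+n] n) ⟩
    suc n * 2 ℕ.+ n * suc n
  ≡⟨ factor n ⟩
    suc n * suc (suc n)
  ∎
  where
  open ≡.≡-Reasoning
  factor : ∀ n → suc n * 2 ℕ.+ n * suc n ≡.≡ suc n * suc (suc n)
  factor = solve-∀

module FiniteDifferences {c ℓ : Level} (R : CommutativeRing c ℓ) where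
  open CommutativeRing R hiding (zero) renaming (_*_ to _·_)
  open Fam R
  open import Algebra.Properties.Ring ring using (-1*x≈-x; -0#≈0#; -‿involutive)
  open import Algebra.Properties.CommutativeSemigroup +-commutativeSemigroup using (interchange)
  open import Algebra.Properties.CommutativeSemigroup *-commutativeSemigroup using (x∙yz≈y∙xz)
  open import Algebra.Properties.Semiring.Mult semiring using (_×_; ×-homo-+; ×1-homo-*)
  open import Algebra.Solver.Ring.NaturalCoefficients.Default commutativeSemiring
  open import Relation.Binary.Reasoning.Setoid setoid

  fromℕ≈×1# : ∀ n → fromℕ n ≈ n × 1#
  fromℕ≈×1# zero    = refl
  fromℕ≈×1# (suc n) = +-congˡ (fromℕ≈×1# n)

  fromℕ-homo-+ : ∀ m n → fromℕ (m ℕ.+ n) ≈ fromℕ m + fromℕ n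
  fromℕ-homo-+ m n = begin
    fromℕ (m ℕ.+ n)          ≈⟨ fromℕ≈×1# (m ℕ.+ n) ⟩
    (m ℕ.+ n) × 1#           ≈⟨ ×-homo-+ 1# m n ⟩
    m × 1# + n × 1#          ≈⟨ +-cong (fromℕ≈×1# m) (fromℕ≈×1# n) ⟨
    fromℕ m + fromℕ n        ∎

  fromℕ-homo-* : ∀ m n → fromℕ (m * n) ≈ fromℕ m · fromℕ n
  fromℕ-homo-* m n = begin
    fromℕ (m * n)            ≈⟨ fromℕ≈×1# (m * n) ⟩
    (m * n) × 1#             ≈⟨ ×1-homo-* m n ⟩
    m × 1# · n × 1#          ≈⟨ *-cong (fromℕ≈×1# m) (fromℕ≈×1# n) ⟨
    fromℕ m · fromℕ n        ∎

  sgn²≈1 : ∀ n → sgn n · sgn n ≈ 1#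
  sgn²≈1 zero    = *-identityˡ 1#
  sgn²≈1 (suc n) = begin
    (- 1# · sgn n) · (- 1# · sgn n)     ≈⟨ solve 2 (λ m s → (m :* s) :* (m :* s) := (m :* m) :* (s :* s)) refl (- 1#) (sgn n) ⟩
    (- 1# · - 1#) · (sgn n · sgn n)     ≈⟨ *-cong (trans (-1*x≈-x (- 1#)) (-‿involutive 1#)) (sgn²≈1 n) ⟩
    1# · 1#                             ≈⟨ *-identityˡ 1# ⟩
    1#                                  ∎

  sum1-cong : ∀ n {f g : ℕ → Carrier} → (∀ l → f l ≈ g l) → sum1 n f ≈ sum1 n g
  sum1-cong zero    f≈g = refl
  sum1-cong (suc n) f≈g = +-cong (sum1-cong n f≈g) (f≈g (suc n))

  sum1-+ : ∀ n (f g : ℕ → Carrier) → sum1 n (λ l → f l + g l) ≈ sum1 n f + sum1 n g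
  sum1-+ zero    f g = sym (+-identityˡ 0#)
  sum1-+ (suc n) f g = trans (+-congʳ (sum1-+ n f g)) (interchange _ _ _ _)

  sum1-*ˡ : ∀ n a (f : ℕ → Carrier) → sum1 n (λ l → a · f l) ≈ a · sum1 n f
  sum1-*ˡ zero    a f = sym (zeroʳ a)
  sum1-*ˡ (suc n) a f = trans (+-congʳ (sum1-*ˡ n a f)) (sym (distribˡ a _ _))

  sum1-const : ∀ n a → sum1 n (λ _ → a) ≈ fromℕ n · a
  sum1-const zero    a = sym (zeroˡ a)
  sum1-const (suc n) a = begin
    sum1 n (λ _ → a) + a     ≈⟨ +-congʳ (sum1-const n a) ⟩
    fromℕ n · a + a          ≈⟨ +-comm _ a ⟩
    a + fromℕ n · a          ≈⟨ +-congʳ (*-identityˡ a) ⟨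
    1# · a + fromℕ n · a     ≈⟨ distribʳ a 1# (fromℕ n) ⟨
    fromℕ (suc n) · a        ∎

  sum0 : ℕ → (ℕ → Carrier) → Carrier
  sum0 n f = f zero + sum1 n f

  sum0-cong : ∀ n {f g : ℕ → Carrier} → (∀ l → f l ≈ g l) → sum0 n f ≈ sum0 n g
  sum0-cong n f≈g = +-cong (f≈g zero) (sum1-cong n f≈g)

  sum0-+ : ∀ n (f g : ℕ → Carrier) → sum0 n (λ l → f l + g l) ≈ sum0 n f + sum0 n g
  sum0-+ n f g = trans (+-congˡ (sum1-+ n f g)) (interchange _ _ _ _)

  sum0-*ˡ : ∀ n a (f : ℕ → Carrier) → sum0 n (λ l → a · f l) ≈ a · sum0 n f
  sum0-*ˡ n a f = trans (+-congˡ (sum1-*ˡ n a f)) (sym (distribˡ a _ _))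

  sum0-suc : ∀ n (f : ℕ → Carrier) → sum0 (suc n) f ≈ sum0 n f + f (suc n)
  sum0-suc n f = sym (+-assoc _ _ _)

  sum1-suc : ∀ n (f : ℕ → Carrier) → sum1 (suc n) f ≈ sum0 n (f ∘ suc)
  sum1-suc zero    f = +-comm 0# (f 1)
  sum1-suc (suc n) f = trans (+-congʳ (sum1-suc n f)) (+-assoc _ _ _)

  prod1-cong : ∀ n {f g : ℕ → Carrier} → (∀ l → f l ≈ g l) → prod1 n f ≈ prod1 n g
  prod1-cong zero    f≈g = refl
  prod1-cong (suc n) f≈g = *-cong (prod1-cong n f≈g) (f≈g (suc n))

  -- (-1)ⁿ times the n-th forward difference of f at 0
  Δ : ℕ → (ℕ → Carrier) → Carrier
  Δ n f = sum0 n (λ l → sgn l · fromℕ (n C l) · f l)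

  Δ-cong : ∀ n {f g : ℕ → Carrier} → (∀ l → f l ≈ g l) → Δ n f ≈ Δ n g
  Δ-cong n f≈g = sum0-cong n (λ l → *-congˡ (f≈g l))

  Δ-+ : ∀ n (f g : ℕ → Carrier) → Δ n (λ l → f l + g l) ≈ Δ n f + Δ n g
  Δ-+ n f g = trans (sum0-cong n (λ l → distribˡ _ (f l) (g l))) (sum0-+ n _ _)

  Δ-*ˡ : ∀ n a (f : ℕ → Carrier) → Δ n (λ l → a · f l) ≈ a · Δ n f
  Δ-*ˡ n a f = trans (sum0-cong n (λ l → x∙yz≈y∙xz _ a (f l))) (sum0-*ˡ n a _)

  alternating-partial-sum : ∀ k j → sum0 j (λ l → sgn l · fromℕ (suc k C l)) ≈ sgn j · fromℕ (k C j)
  alternating-partial-sum k zero    = +-identityʳ _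
  alternating-partial-sum k (suc j) = begin
      sum0 (suc j) (λ l → sgn l · fromℕ (suc k C l))
    ≈⟨ sum0-suc j _ ⟩
      sum0 j (λ l → sgn l · fromℕ (suc k C l)) + - 1# · sgn j · fromℕ (suc k C suc j)
    ≈⟨ +-cong (alternating-partial-sum k j) (*-congˡ pascal) ⟩
      sgn j · B + - 1# · sgn j · (B + B′)
    ≈⟨ solve 4 (λ m s B B′ → s :* B :+ m :* s :* (B :+ B′) := (s :* B :+ m :* (s :* B)) :+ m :* s :* B′)
             refl (- 1#) (sgn j) B B′ ⟩
      (sgn j · B + - 1# · (sgn j · B)) + - 1# · sgn j · B′
    ≈⟨ +-congʳ (trans (+-congˡ (-1*x≈-x _)) (-‿inverseʳ _)) ⟩
      0# + - 1# · sgn j · B′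
    ≈⟨ +-identityˡ _ ⟩
      sgn (suc j) · B′
    ∎
    where
    B  = fromℕ (k C j)
    B′ = fromℕ (k C suc j)
    pascal : fromℕ (suc k C suc j) ≈ B + B′
    pascal = trans (reflexive (≡.cong fromℕ (≡.sym (nCk+nC[k+1]≡[n+1]C[k+1] k j)))) (fromℕ-homo-+ (k C j) (k C suc j))

  Δ-const : ∀ k a → Δ (suc k) (λ _ → a) ≈ 0#
  Δ-const k a = begin
      Δ (suc k) (λ _ → a)
    ≈⟨ sum0-cong (suc k) (λ l → *-comm _ a) ⟩
      sum0 (suc k) (λ l → a · (sgn l · fromℕ (suc k C l)))
    ≈⟨ sum0-*ˡ (suc k) a _ ⟩
      a · sum0 (suc k) (λ l → sgn l · fromℕ (suc k C l))
    ≈⟨ *-congˡ (alternating-partial-sum k (suc k)) ⟩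
      a · (sgn (suc k) · fromℕ (k C suc k))
    ≈⟨ *-congˡ (*-congˡ (reflexive (≡.cong fromℕ (k>n⇒nCk≡0 (n<1+n k))))) ⟩
      a · (sgn (suc k) · 0#)
    ≈⟨ trans (*-congˡ (zeroʳ _)) (zeroʳ a) ⟩
      0#
    ∎

  Δ-id*≈sum1 : ∀ n (g : ℕ → Carrier) →
               Δ n (λ l → fromℕ l · g l) ≈ sum1 n (λ l → sgn l · fromℕ (n C l) · (fromℕ l · g l))
  Δ-id*≈sum1 n g = trans (+-congʳ (trans (*-congˡ (zeroˡ (g zero))) (zeroʳ _))) (+-identityˡ _)

  Δ-suc-id* : ∀ k (g : ℕ → Carrier) → Δ (suc k) (λ l → fromℕ l · g l) ≈ - (fromℕ (suc k) · Δ k (g ∘ suc))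
  Δ-suc-id* k g = begin
      Δ (suc k) (λ l → fromℕ l · g l)
    ≈⟨ Δ-id*≈sum1 (suc k) g ⟩
      sum1 (suc k) (λ l → sgn l · fromℕ (suc k C l) · (fromℕ l · g l))
    ≈⟨ sum1-suc k _ ⟩
      sum0 k (λ j → - 1# · sgn j · fromℕ (suc k C suc j) · (fromℕ (suc j) · g (suc j)))
    ≈⟨ sum0-cong k absorbed ⟩
      sum0 k (λ j → - 1# · (K · (sgn j · fromℕ (k C j) · g (suc j))))
    ≈⟨ trans (sum0-*ˡ k (- 1#) _) (*-congˡ (sum0-*ˡ k K _)) ⟩
      - 1# · (K · Δ k (g ∘ suc))
    ≈⟨ -1*x≈-x _ ⟩
      - (K · Δ k (g ∘ suc))
    ∎
    where
    K = fromℕ (suc k)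
    absorption : ∀ j → fromℕ (suc j) · fromℕ (suc k C suc j) ≈ K · fromℕ (k C j)
    absorption j = begin
      fromℕ (suc j) · fromℕ (suc k C suc j)   ≈⟨ fromℕ-homo-* (suc j) (suc k C suc j) ⟨
      fromℕ (suc j * (suc k C suc j))         ≈⟨ reflexive (≡.cong fromℕ ([k+1]*[n+1]C[k+1]≡[n+1]*nCk k j)) ⟩
      fromℕ (suc k * (k C j))                 ≈⟨ fromℕ-homo-* (suc k) (k C j) ⟩
      K · fromℕ (k C j)                       ∎
    absorbed : ∀ j → - 1# · sgn j · fromℕ (suc k C suc j) · (fromℕ (suc j) · g (suc j)) ≈
                     - 1# · (K · (sgn j · fromℕ (k C j) · g (suc j)))
    absorbed j = begin
        - 1# · sgn j · Bj · (J · G)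
      ≈⟨ solve 5 (λ m s B J G → m :* s :* B :* (J :* G) := m :* (s :* (J :* B) :* G)) refl (- 1#) (sgn j) Bj J G ⟩
        - 1# · (sgn j · (J · Bj) · G)
      ≈⟨ *-congˡ (*-congʳ (*-congˡ (absorption j))) ⟩
        - 1# · (sgn j · (K · b) · G)
      ≈⟨ solve 5 (λ m s K b G → m :* (s :* (K :* b) :* G) := m :* (K :* (s :* b :* G))) refl (- 1#) (sgn j) K b G ⟩
        - 1# · (K · (sgn j · b · G))
      ∎
      where
      Bj = fromℕ (suc k C suc j)
      J  = fromℕ (suc j)
      G  = g (suc j)
      b  = fromℕ (k C j)

  linProd : ℕ → (ℕ → Carrier) → ℕ → Carrier
  linProd m ys l = prod1 m (λ i → fromℕ l + ys i)

  incr : (ℕ → Carrier) → ℕ → Carrier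
  incr ys i = 1# + ys i

  sum1-incr : ∀ n ys → sum1 n (incr ys) ≈ fromℕ n + sum1 n ys
  sum1-incr n ys = trans (sum1-+ n (λ _ → 1#) ys) (+-congʳ (trans (sum1-const n 1#) (*-identityʳ _)))

  linProd-suc-arg : ∀ m ys l → linProd m ys (suc l) ≈ linProd m (incr ys) l
  linProd-suc-arg m ys l =
    prod1-cong m (λ i → solve 3 (λ o t y → (o :+ t) :+ y := t :+ (o :+ y)) refl 1# (fromℕ l) (ys i))

  linProd-suc : ∀ m ys l → linProd (suc m) ys l ≈ fromℕ l · linProd m ys l + ys (suc m) · linProd m ys l
  linProd-suc m ys l = trans (distribˡ _ _ _) (+-cong (*-comm _ _) (*-comm _ _))

  Δ-linProd-suc : ∀ n m ys →
    Δ n (linProd (suc m) ys) ≈ Δ n (λ l → fromℕ l · linProd m ys l) + ys (suc m) · Δ n (linProd m ys)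
  Δ-linProd-suc n m ys = trans (Δ-cong n (linProd-suc m ys)) (trans (Δ-+ n _ _) (+-congˡ (Δ-*ˡ n _ _)))

  Δ-suc-id*linProd : ∀ k m ys →
    Δ (suc k) (λ l → fromℕ l · linProd m ys l) ≈ - (fromℕ (suc k) · Δ k (linProd m (incr ys)))
  Δ-suc-id*linProd k m ys = trans (Δ-suc-id* k _) (-‿cong (*-congˡ (Δ-cong k (linProd-suc-arg m ys))))

  Δ-linProd-< : ∀ {m n} ys → m < n → Δ n (linProd m ys) ≈ 0#
  Δ-linProd-< {zero}  {suc k} ys _          = Δ-const k 1#
  Δ-linProd-< {suc m} {suc k} ys (s≤s m<k) = begin
      Δ (suc k) (linProd (suc m) ys)
    ≈⟨ Δ-linProd-suc (suc k) m ys ⟩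
      Δ (suc k) (λ l → fromℕ l · linProd m ys l) + ys (suc m) · Δ (suc k) (linProd m ys)
    ≈⟨ +-cong (Δ-suc-id*linProd k m ys) (*-congˡ (Δ-linProd-< ys (m<n⇒m<1+n m<k))) ⟩
      - (fromℕ (suc k) · Δ k (linProd m (incr ys))) + ys (suc m) · 0#
    ≈⟨ +-cong (-‿cong (*-congˡ (Δ-linProd-< (incr ys) m<k))) (zeroʳ _) ⟩
      - (fromℕ (suc k) · 0#) + 0#
    ≈⟨ trans (+-identityʳ _) (trans (-‿cong (zeroʳ _)) -0#≈0#) ⟩
      0#
    ∎

  Δ-linProd-≡ : ∀ n ys → Δ n (linProd n ys) ≈ sgn n · fromℕ (n !)
  Δ-linProd-≡ zero    ys = trans (+-identityʳ _) (*-identityʳ _)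
  Δ-linProd-≡ (suc k) ys = begin
      Δ (suc k) (linProd (suc k) ys)
    ≈⟨ Δ-linProd-suc (suc k) k ys ⟩
      Δ (suc k) (λ l → fromℕ l · linProd k ys l) + ys (suc k) · Δ (suc k) (linProd k ys)
    ≈⟨ +-cong (Δ-suc-id*linProd k k ys) (*-congˡ (Δ-linProd-< ys (n<1+n k))) ⟩
      - (K · Δ k (linProd k (incr ys))) + ys (suc k) · 0#
    ≈⟨ +-cong (-‿cong (*-congˡ (Δ-linProd-≡ k (incr ys)))) (zeroʳ _) ⟩
      - (K · (sgn k · N)) + 0#
    ≈⟨ trans (+-identityʳ _) (sym (-1*x≈-x _)) ⟩
      - 1# · (K · (sgn k · N))
    ≈⟨ solve 4 (λ m K s N → m :* (K :* (s :* N)) := (m :* s) :* (K :* N)) refl (- 1#) K (sgn k) N ⟩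
      - 1# · sgn k · (K · N)
    ≈⟨ *-congˡ (fromℕ-homo-* (suc k) (k !)) ⟨
      sgn (suc k) · fromℕ (suc k !)
    ∎
    where
    K = fromℕ (suc k)
    N = fromℕ (k !)

  Δ-id*linProd : ∀ n ys →
    Δ n (λ l → fromℕ l · linProd n ys l) ≈ sgn n · fromℕ (n !) · (sum1 n ys + fromℕ (triangular n))
  Δ-linProd-suc≡ : ∀ n ys →
    Δ n (linProd (suc n) ys) ≈ sgn n · fromℕ (n !) · (sum1 (suc n) ys + fromℕ (triangular n))

  Δ-id*linProd zero    ys = trans (Δ-id*≈sum1 0 (linProd 0 ys)) (sym (trans (*-congˡ (+-identityˡ 0#)) (zeroʳ _)))
  Δ-id*linProd (suc k) ys = begin
      Δ (suc k) (λ l → fromℕ l · linProd (suc k) ys l)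
    ≈⟨ Δ-suc-id*linProd k (suc k) ys ⟩
      - (K · Δ k (linProd (suc k) (incr ys)))
    ≈⟨ -‿cong (*-congˡ (Δ-linProd-suc≡ k (incr ys))) ⟩
      - (K · (sgn k · N · (sum1 (suc k) (incr ys) + T)))
    ≈⟨ -‿cong (*-congˡ (*-congˡ (+-congʳ (sum1-incr (suc k) ys)))) ⟩
      - (K · (sgn k · N · ((K + E) + T)))
    ≈⟨ -1*x≈-x _ ⟨
      - 1# · (K · (sgn k · N · ((K + E) + T)))
    ≈⟨ solve 6 (λ m K s N E T → m :* (K :* (s :* N :* ((K :+ E) :+ T))) := (m :* s) :* (K :* N) :* (E :+ (K :+ T)))
             refl (- 1#) K (sgn k) N E T ⟩
      - 1# · sgn k · (K · N) · (E + (K + T))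
    ≈⟨ *-cong (*-congˡ (fromℕ-homo-* (suc k) (k !))) (+-congˡ (fromℕ-homo-+ (suc k) (triangular k))) ⟨
      sgn (suc k) · fromℕ (suc k !) · (sum1 (suc k) ys + fromℕ (triangular (suc k)))
    ∎
    where
    K = fromℕ (suc k)
    N = fromℕ (k !)
    T = fromℕ (triangular k)
    E = sum1 (suc k) ys

  Δ-linProd-suc≡ n ys = begin
      Δ n (linProd (suc n) ys)
    ≈⟨ Δ-linProd-suc n n ys ⟩
      Δ n (λ l → fromℕ l · linProd n ys l) + y · Δ n (linProd n ys)
    ≈⟨ +-cong (Δ-id*linProd n ys) (*-congˡ (Δ-linProd-≡ n ys)) ⟩
      s · N · (E + T) + y · (s · N)
    ≈⟨ solve 5 (λ s N E T y → s :* N :* (E :+ T) :+ y :* (s :* N) := s :* N :* ((E :+ y) :+ T)) refl s N E T y ⟩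
      s · N · ((E + y) + T)
    ∎
    where
    s = sgn n
    N = fromℕ (n !)
    E = sum1 n ys
    T = fromℕ (triangular n)
    y = ys (suc n)

  S≈Δ : ∀ x n → S x n ≈ Δ n (λ l → fromℕ l · linProd n (x n) l)
  S≈Δ x n = sym (trans (Δ-id*≈sum1 n _) (sum1-cong n (λ l → sym (*-assoc _ _ _))))

  halve-n*[1+n] : ∀ n {h} → h · fromℕ 2 ≈ 1# → h · fromℕ (n * suc n) ≈ fromℕ (triangular n)
  halve-n*[1+n] n {h} h·2≈1 = begin
      h · fromℕ (n * suc n)
    ≈⟨ *-congˡ (reflexive (≡.cong fromℕ (≡.sym (triangular[n]*2≡n*[1+n] n)))) ⟩
      h · fromℕ (triangular n * 2)
    ≈⟨ *-congˡ (fromℕ-homo-* (triangular n) 2) ⟩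
      h · (T · fromℕ 2)
    ≈⟨ x∙yz≈y∙xz h T (fromℕ 2) ⟩
      T · (h · fromℕ 2)
    ≈⟨ trans (*-congˡ h·2≈1) (*-identityʳ T) ⟩
      T
    ∎
    where T = fromℕ (triangular n)

-- The identity holds for n = 0 as well (both sides vanish).
lemma2p1 : {c ℓ : Level} (R : CommutativeRing c ℓ) (x : ℕ → ℕ → CommutativeRing.Carrier R)
           (n : ℕ) → 1 ≤ n →
           (invFact inv2 : CommutativeRing.Carrier R) →
           CommutativeRing._≈_ R (CommutativeRing._*_ R invFact (Fam.fromℕ R (n !))) (CommutativeRing.1# R) →
           CommutativeRing._≈_ R (CommutativeRing._*_ R inv2 (Fam.fromℕ R 2)) (CommutativeRing.1# R) →
           CommutativeRing._≈_ R (Fam.𝒳 R x n)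
             (CommutativeRing._-_ R
               (CommutativeRing._*_ R (CommutativeRing._*_ R (Fam.sgn R n) invFact) (Fam.S R x n))
               (CommutativeRing._*_ R inv2 (Fam.fromℕ R (n * suc n))))
lemma2p1 R x n _ invFact inv2 invFact·n!≈1 inv2·2≈1 = sym (begin
    (sgn n · invFact) · S x n - inv2 · fromℕ (n * suc n)
  ≈⟨ +-cong (*-congˡ (trans (S≈Δ x n) (Δ-id*linProd n (x n)))) (-‿cong (halve-n*[1+n] n inv2·2≈1)) ⟩
    (sgn n · invFact) · (sgn n · N · (𝒳 x n + T)) - T
  ≈⟨ +-congʳ (solve 5 (λ s i N E T → (s :* i) :* (s :* N :* (E :+ T)) := (s :* s) :* (i :* N) :* (E :+ T))
                refl (sgn n) invFact N (𝒳 x n) T) ⟩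
    (sgn n · sgn n) · (invFact · N) · (𝒳 x n + T) - T
  ≈⟨ +-congʳ (trans (*-congʳ (trans (*-cong (sgn²≈1 n) invFact·n!≈1) (*-identityˡ 1#))) (*-identityˡ _)) ⟩
    (𝒳 x n + T) - T
  ≈⟨ trans (+-assoc _ T (- T)) (trans (+-congˡ (-‿inverseʳ T)) (+-identityʳ _)) ⟩
    𝒳 x n
  ∎)
  where
  open CommutativeRing R hiding (zero) renaming (_*_ to _·_)
  open Fam R
  open FiniteDifferences R
  open import Algebra.Solver.Ring.NaturalCoefficients.Default commutativeSemiring
  open import Relation.Binary.Reasoning.Setoid setoid
  N = fromℕ (n !)
  T = fromℕ (triangular n)
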